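{- Let $A$ be a finite quadratic form on an elementary abelian $2$-group and let $x,y\in A$ be nonzero elements, neither equal to the characteristic element $x_A$. Then $x$ and $y$ lie in the same $\mathrm{O}(A)$-orbit if and only if $(x,x)=(y,y)$ in $\mathbb{Q}/2\mathbb{Z}$.
   Context: A finite quadratic form is a finite abelian group $A$ with $q:A\to\mathbb{Q}/\mathbb{Z}$ such that $q(nx)=n^2q(x)$ and $(x,y):=q(x+y)-q(x)-q(y)$ is a nondegenerate symmetric bilinear form; $\mathrm{O}(A)$ is the group of automorphisms preserving $q$. For $x\in A$, the norm $(x,x):=2q(x)$ is regarded as an element of $\mathbb{Q}/2\mathbb{Z}$. When $A$ is an elementary abelian $2$-group, the characteristic element $x_A$ is the unique element of $A$ with $(x,x_A)\equiv(x,x)\bmod\mathbb{Z}$ for all $x\in A$. -}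

module Defs where

open import Data.Bool using (Bool; true; false; _xor_)
open import Data.Nat using (ℕ; zero; suc)
open import Data.Integer using (ℤ; +_)
open import Data.Rational using (ℚ; _/_; _+_; _-_; _*_; 0ℚ)
open import Data.Vec using (Vec; replicate; zipWith)
open import Data.Product using (Σ; ∃; _×_; _,_)
open import Function.Bundles using (_↔_; Inverse)
open import Relation.Binary.PropositionalEquality using (_≡_)
open import Relation.Nullary using (¬_)

E₂ : ℕ → Set
E₂ n = Vec Bool n

0ᴱ : ∀ {n} → E₂ n
0ᴱ {n} = replicate n false

_⊕_ : ∀ {n} → E₂ n → E₂ n → E₂ n
_⊕_ = zipWith _xor_

_·ᴱ_ : ∀ {n} → ℕ → E₂ n → E₂ n
zero  ·ᴱ x = 0ᴱ
suc m ·ᴱ x = x ⊕ (m ·ᴱ x)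

-- ℚ/ℤ and ℚ/2ℤ, represented by rationals up to the congruences below.
_≡[modℤ]_ : ℚ → ℚ → Set
a ≡[modℤ] b = Σ ℤ λ k → a - b ≡ k / 1

_≡[mod2ℤ]_ : ℚ → ℚ → Set
a ≡[mod2ℤ] b = Σ ℤ λ k → a - b ≡ (k Data.Integer.* + 2) / 1

ℕtoℚ : ℕ → ℚ
ℕtoℚ m = + m / 1

-- A finite quadratic form on (ℤ/2)^n: q : A → ℚ/ℤ (values given by rational
-- representatives, all identities read modulo ℤ).
record FQF (n : ℕ) : Set where
  field
    q : E₂ n → ℚ
  b : E₂ n → E₂ n → ℚ
  b x y = q (x ⊕ y) - q x - q y
  field
    q-homog  : ∀ (m : ℕ) x → q (m ·ᴱ x) ≡[modℤ] (ℕtoℚ m * ℕtoℚ m * q x)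
    b-symm   : ∀ x y → b x y ≡[modℤ] b y x
    b-additiveˡ : ∀ x y z → b (x ⊕ y) z ≡[modℤ] (b x z + b y z)
    b-nondeg : ∀ x → (∀ y → b x y ≡[modℤ] 0ℚ) → x ≡ 0ᴱ
  -- the norm (x,x) := 2 q(x), regarded in ℚ/2ℤ (compare with _≡[mod2ℤ]_)
  norm : E₂ n → ℚ
  norm x = ℕtoℚ 2 * q x

open FQF public

IsCharacteristic : ∀ {n} (A : FQF n) → E₂ n → Set
IsCharacteristic A c = ∀ x → b A x c ≡[modℤ] norm A x

record Orth {n : ℕ} (A : FQF n) : Set where
  field
    iso      : E₂ n ↔ E₂ n
  σ : E₂ n → E₂ n
  σ = Inverse.to iso
  field
    additive : ∀ x y → σ (x ⊕ y) ≡ σ x ⊕ σ y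
    preserves-q : ∀ x → q A (σ x) ≡[modℤ] q A x

open Orth public

SameOrbit : ∀ {n} (A : FQF n) → E₂ n → E₂ n → Set
SameOrbit A x y = Σ (Orth A) λ g → σ g x ≡ y

{-# OPTIONS --safe #-}
-- Since 4 q(x) ≡ q(2x) = q(0) ≡ 0, the form q takes values in ¼ℤ/ℤ ≅ ℤ/4 and (x,y) in ½ℤ/ℤ ≅ 𝔽₂,
-- so A is an 𝔽₂-space with a ℤ/4-valued quadratic refinement Q of a nondegenerate bilinear form β,
-- and (x,x) mod 2ℤ is determined by Q x. Let Q x = Q y and v = x + y. If β(x,v) = 1 then Q v = 2
-- and the transvection z ↦ z + β(z,v) v maps x to y. Otherwise, as x lies outside the span of v
-- and x_A, there is u with β(u,x) = β(u,y) = 1 and β(u,x_A) = 0; then β(u,u) = 0, so Q u ∈ {0,2}.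
-- If Q u = 0 the Siegel transformation z ↦ z + β(z,u) v + β(z,v) u maps x to y; if Q u = 2 the
-- transvection along u moves x to x + u, to which the first case applies.
module Submission where

open import Defs
open import Data.Bool using (Bool; true; false; _xor_; _∧_)
open import Data.Bool.Properties
  using (xor-comm; xor-assoc; xor-identityˡ; xor-identityʳ; xor-same; ∧-zeroʳ; ∧-idem; ∧-comm; ¬-not)
  renaming (_≟_ to _≟ᴮ_)
open import Data.Nat as ℕ using (ℕ; zero; suc; s≤s)
open import Data.Integer as ℤ using (ℤ; +_; -[1+_])
import Data.Integer.Properties as ℤ
open import Data.Integer.DivMod using (_%ℕ_; _/ℕ_; a≡a%ℕn+[a/ℕn]*n; n%ℕd<d)
open import Data.Integer.Tactic.RingSolver using (solve-∀)
open import Data.Rational as ℚ using (ℚ; _/_; 0ℚ; toℚᵘ)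
open import Data.Rational.Properties using (toℚᵘ-fromℚᵘ; toℚᵘ-injective; toℚᵘ-homo-+; toℚᵘ-homo-*)
open import Data.Rational.Unnormalised as ℚᵘ using (mkℚᵘ; *≡*) renaming (_≃_ to _≃ᵘ_)
import Data.Rational.Unnormalised.Properties as ℚᵘ
open import Data.Rational.Solver using (module +-*-Solver)
open +-*-Solver using (solve; _:+_; _:-_; _:*_; :-_; con; _:=_)
open import Data.Vec using ([]; _∷_)
open import Data.Vec.Properties using (zipWith-comm; zipWith-assoc; zipWith-identityˡ; zipWith-identityʳ)
open import Data.List using (List; []; _∷_)
open import Data.List.Relation.Unary.All as All using (All; []; _∷_)
open import Data.Product using (Σ; ∃; _×_; _,_; proj₁; proj₂)
open import Data.Sum using (_⊎_; inj₁; inj₂)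
open import Function.Bundles using (_↔_; Inverse; mk↔ₛ′)
open import Function.Construct.Composition using (_↔-∘_)
open import Relation.Binary.Definitions using (DecidableEquality)
open import Relation.Binary.PropositionalEquality hiding ([_])
open import Relation.Nullary using (Dec; yes; no; ¬_; contradiction)
import Relation.Nullary.Decidable as Dec
open import Relation.Nullary.Decidable using (from-yes; _→-dec_; _⊎-dec_)
open import Relation.Unary using (Decidable)

-- ℤ/4ℤ

data ℤ₄ : Set where
  0₄ 1₄ 2₄ 3₄ : ℤ₄

suc₄ : ℤ₄ → ℤ₄
suc₄ 0₄ = 1₄
suc₄ 1₄ = 2₄
suc₄ 2₄ = 3₄
suc₄ 3₄ = 0₄

pred₄ : ℤ₄ → ℤ₄
pred₄ 0₄ = 3₄
pred₄ 1₄ = 0₄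
pred₄ 2₄ = 1₄
pred₄ 3₄ = 2₄

infixl 6 _+₄_
infix  4 _≟₄_

_+₄_ : ℤ₄ → ℤ₄ → ℤ₄
0₄ +₄ b = b
1₄ +₄ b = suc₄ b
2₄ +₄ b = suc₄ (suc₄ b)
3₄ +₄ b = pred₄ b

_≟₄_ : DecidableEquality ℤ₄
0₄ ≟₄ 0₄ = yes refl
1₄ ≟₄ 1₄ = yes refl
2₄ ≟₄ 2₄ = yes refl
3₄ ≟₄ 3₄ = yes refl
0₄ ≟₄ 1₄ = no λ ()
0₄ ≟₄ 2₄ = no λ ()
0₄ ≟₄ 3₄ = no λ ()
1₄ ≟₄ 0₄ = no λ ()
1₄ ≟₄ 2₄ = no λ ()
1₄ ≟₄ 3₄ = no λ ()
2₄ ≟₄ 0₄ = no λ ()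
2₄ ≟₄ 1₄ = no λ ()
2₄ ≟₄ 3₄ = no λ ()
3₄ ≟₄ 0₄ = no λ ()
3₄ ≟₄ 1₄ = no λ ()
3₄ ≟₄ 2₄ = no λ ()

all₄? : ∀ {p} {P : ℤ₄ → Set p} → Decidable P → Dec (∀ a → P a)
all₄? P? with P? 0₄ | P? 1₄ | P? 2₄ | P? 3₄
... | yes p₀ | yes p₁ | yes p₂ | yes p₃ = yes λ { 0₄ → p₀ ; 1₄ → p₁ ; 2₄ → p₂ ; 3₄ → p₃ }
... | no ¬p  | _      | _      | _      = no λ p → ¬p (p 0₄)
... | yes _  | no ¬p  | _      | _      = no λ p → ¬p (p 1₄)
... | yes _  | yes _  | no ¬p  | _      = no λ p → ¬p (p 2₄)
... | yes _  | yes _  | yes _  | no ¬p  = no λ p → ¬p (p 3₄)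

+₄-identityʳ : ∀ a → a +₄ 0₄ ≡ a
+₄-identityʳ = from-yes (all₄? λ a → a +₄ 0₄ ≟₄ a)

+₄-comm : ∀ a b → a +₄ b ≡ b +₄ a
+₄-comm = from-yes (all₄? λ a → all₄? λ b → a +₄ b ≟₄ b +₄ a)

+₄-assoc : ∀ a b c → a +₄ b +₄ c ≡ a +₄ (b +₄ c)
+₄-assoc = from-yes (all₄? λ a → all₄? λ b → all₄? λ c → a +₄ b +₄ c ≟₄ a +₄ (b +₄ c))

+₄-cancelˡ : ∀ a b c → a +₄ b ≡ a +₄ c → b ≡ c
+₄-cancelˡ = from-yes (all₄? λ a → all₄? λ b → all₄? λ c → (a +₄ b ≟₄ a +₄ c) →-dec (b ≟₄ c))

a+a≡0⇒a≡0⊎a≡2 : ∀ a → a +₄ a ≡ 0₄ → a ≡ 0₄ ⊎ a ≡ 2₄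
a+a≡0⇒a≡0⊎a≡2 0₄ _ = inj₁ refl
a+a≡0⇒a≡0⊎a≡2 2₄ _ = inj₂ refl

twice : Bool → ℤ₄
twice false = 0₄
twice true  = 2₄

half : ℤ₄ → Bool
half 2₄ = true
half _  = false

twice-xor : ∀ a b → twice (a xor b) ≡ twice a +₄ twice b
twice-xor false b     = refl
twice-xor true  false = refl
twice-xor true  true  = refl

twice-injective : ∀ {a b} → twice a ≡ twice b → a ≡ b
twice-injective {false} {false} _ = refl
twice-injective {true}  {true}  _ = refl

twice+twice≡0 : ∀ b → twice b +₄ twice b ≡ 0₄
twice+twice≡0 false = refl
twice+twice≡0 true  = refl

twice-half : ∀ a → a +₄ a ≡ 0₄ → twice (half a) ≡ a
twice-half 0₄ _ = refl
twice-half 2₄ _ = refl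

fromℕ₄ : ℕ → ℤ₄
fromℕ₄ zero    = 0₄
fromℕ₄ (suc n) = suc₄ (fromℕ₄ n)

[_] : ℤ → ℤ₄
[ + n ]          = fromℕ₄ n
[ -[1+ zero ] ]  = 3₄
[ -[1+ suc n ] ] = pred₄ [ -[1+ n ] ]

[suc] : ∀ a → [ ℤ.suc a ] ≡ suc₄ [ a ]
[suc] (+ n)          = refl
[suc] -[1+ zero ]    = refl
[suc] -[1+ suc n ]   = sym (from-yes (all₄? λ a → suc₄ (pred₄ a) ≟₄ a) [ -[1+ n ] ])

[pred] : ∀ a → [ ℤ.pred a ] ≡ pred₄ [ a ]
[pred] (+ zero)  = refl
[pred] (+ suc n) = sym (from-yes (all₄? λ a → pred₄ (suc₄ a) ≟₄ a) (fromℕ₄ n))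
[pred] -[1+ n ]  = refl

[+] : ∀ a b → [ a ℤ.+ b ] ≡ [ a ] +₄ [ b ]
[+] a (+ zero) = trans (cong [_] (ℤ.+-identityʳ a)) (sym (+₄-identityʳ [ a ]))
[+] a (+ suc n) = begin
  [ a ℤ.+ ℤ.suc (+ n) ]    ≡⟨ cong [_] (a+suc[b]≡suc[a+b] a (+ n)) ⟩
  [ ℤ.suc (a ℤ.+ + n) ]    ≡⟨ [suc] (a ℤ.+ + n) ⟩
  suc₄ [ a ℤ.+ + n ]       ≡⟨ cong suc₄ ([+] a (+ n)) ⟩
  suc₄ ([ a ] +₄ [ + n ])  ≡⟨ from-yes (all₄? λ a → all₄? λ b → suc₄ (a +₄ b) ≟₄ a +₄ suc₄ b) [ a ] [ + n ] ⟩
  [ a ] +₄ [ + suc n ]     ∎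
  where
  open ≡-Reasoning
  a+suc[b]≡suc[a+b] : ∀ a b → a ℤ.+ (+ 1 ℤ.+ b) ≡ + 1 ℤ.+ (a ℤ.+ b)
  a+suc[b]≡suc[a+b] = solve-∀
[+] a -[1+ zero ] = begin
  [ a ℤ.+ -[1+ 0 ] ]       ≡⟨ cong [_] (ℤ.+-comm a -[1+ 0 ]) ⟩
  [ ℤ.pred a ]             ≡⟨ [pred] a ⟩
  pred₄ [ a ]              ≡⟨ from-yes (all₄? λ a → pred₄ a ≟₄ a +₄ 3₄) [ a ] ⟩
  [ a ] +₄ 3₄              ∎
  where open ≡-Reasoning
[+] a -[1+ suc n ] = begin
  [ a ℤ.+ ℤ.pred -[1+ n ] ]     ≡⟨ cong [_] (ℤ.+-pred a -[1+ n ]) ⟩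
  [ ℤ.pred (a ℤ.+ -[1+ n ]) ]   ≡⟨ [pred] (a ℤ.+ -[1+ n ]) ⟩
  pred₄ [ a ℤ.+ -[1+ n ] ]      ≡⟨ cong pred₄ ([+] a -[1+ n ]) ⟩
  pred₄ ([ a ] +₄ [ -[1+ n ] ]) ≡⟨ from-yes (all₄? λ a → all₄? λ b → pred₄ (a +₄ b) ≟₄ a +₄ pred₄ b) [ a ] [ -[1+ n ] ] ⟩
  [ a ] +₄ [ -[1+ suc n ] ]     ∎
  where open ≡-Reasoning

[k*4]≡0 : ∀ k → [ k ℤ.* + 4 ] ≡ 0₄
[k*4]≡0 k = begin
  [ k ℤ.* + 4 ]                          ≡⟨ cong [_] (k*4≡k+k+k+k k) ⟩
  [ k ℤ.+ (k ℤ.+ (k ℤ.+ k)) ]            ≡⟨ [+] k _ ⟩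
  [ k ] +₄ [ k ℤ.+ (k ℤ.+ k) ]           ≡⟨ cong ([ k ] +₄_) ([+] k _) ⟩
  [ k ] +₄ ([ k ] +₄ [ k ℤ.+ k ])        ≡⟨ cong (λ t → [ k ] +₄ ([ k ] +₄ t)) ([+] k k) ⟩
  [ k ] +₄ ([ k ] +₄ ([ k ] +₄ [ k ]))   ≡⟨ from-yes (all₄? λ a → a +₄ (a +₄ (a +₄ a)) ≟₄ 0₄) [ k ] ⟩
  0₄                                     ∎
  where
  open ≡-Reasoning
  k*4≡k+k+k+k : ∀ k → k ℤ.* + 4 ≡ k ℤ.+ (k ℤ.+ (k ℤ.+ k))
  k*4≡k+k+k+k = solve-∀

[a]≡0⇒a≡k*4 : ∀ a → [ a ] ≡ 0₄ → Σ ℤ λ k → a ≡ k ℤ.* + 4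
[a]≡0⇒a≡k*4 a [a]≡0 = k , (begin
  a                          ≡⟨ a≡a%ℕn+[a/ℕn]*n a 4 ⟩
  + r ℤ.+ k ℤ.* + 4          ≡⟨ cong (λ r → + r ℤ.+ k ℤ.* + 4) r≡0 ⟩
  + 0 ℤ.+ k ℤ.* + 4          ≡⟨ ℤ.+-identityˡ _ ⟩
  k ℤ.* + 4                  ∎)
  where
  open ≡-Reasoning
  r = a %ℕ 4
  k = a /ℕ 4
  [r]≡0 : fromℕ₄ r ≡ 0₄
  [r]≡0 = begin
    fromℕ₄ r                   ≡⟨ +₄-identityʳ _ ⟨
    fromℕ₄ r +₄ 0₄             ≡⟨ cong (fromℕ₄ r +₄_) ([k*4]≡0 k) ⟨
    [ + r ] +₄ [ k ℤ.* + 4 ]   ≡⟨ [+] (+ r) (k ℤ.* + 4) ⟨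
    [ + r ℤ.+ k ℤ.* + 4 ]      ≡⟨ cong [_] (a≡a%ℕn+[a/ℕn]*n a 4) ⟨
    [ a ]                      ≡⟨ [a]≡0 ⟩
    0₄                         ∎
  fromℕ₄≡0⇒≡0 : ∀ r → r ℕ.< 4 → fromℕ₄ r ≡ 0₄ → r ≡ 0
  fromℕ₄≡0⇒≡0 zero _ _ = refl
  fromℕ₄≡0⇒≡0 (suc (suc (suc (suc r)))) (s≤s (s≤s (s≤s (s≤s ())))) _
  r≡0 : r ≡ 0
  r≡0 = fromℕ₄≡0⇒≡0 r (n%ℕd<d a 4) [r]≡0

-- Rationals modulo ℤ

ι : ℤ → ℚ
ι k = k / 1

toℚᵘ-ι : ∀ k → toℚᵘ (ι k) ≃ᵘ mkℚᵘ k 0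
toℚᵘ-ι k = toℚᵘ-fromℚᵘ (mkℚᵘ k 0)

ι-+ : ∀ a b → ι (a ℤ.+ b) ≡ ι a ℚ.+ ι b
ι-+ a b = toℚᵘ-injective (begin
  toℚᵘ (ι (a ℤ.+ b))            ≈⟨ toℚᵘ-ι (a ℤ.+ b) ⟩
  mkℚᵘ (a ℤ.+ b) 0              ≈⟨ *≡* (cross-multiplied a b) ⟩
  mkℚᵘ a 0 ℚᵘ.+ mkℚᵘ b 0        ≈⟨ ℚᵘ.+-cong (toℚᵘ-ι a) (toℚᵘ-ι b) ⟨
  toℚᵘ (ι a) ℚᵘ.+ toℚᵘ (ι b)    ≈⟨ toℚᵘ-homo-+ (ι a) (ι b) ⟨
  toℚᵘ (ι a ℚ.+ ι b)            ∎)
  where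
  open ℚᵘ.≃-Reasoning
  cross-multiplied : ∀ a b → (a ℤ.+ b) ℤ.* + 1 ≡ (a ℤ.* + 1 ℤ.+ b ℤ.* + 1) ℤ.* + 1
  cross-multiplied = solve-∀

ι-* : ∀ a b → ι (a ℤ.* b) ≡ ι a ℚ.* ι b
ι-* a b = toℚᵘ-injective (begin
  toℚᵘ (ι (a ℤ.* b))            ≈⟨ toℚᵘ-ι (a ℤ.* b) ⟩
  mkℚᵘ a 0 ℚᵘ.* mkℚᵘ b 0        ≈⟨ ℚᵘ.*-cong (toℚᵘ-ι a) (toℚᵘ-ι b) ⟨
  toℚᵘ (ι a) ℚᵘ.* toℚᵘ (ι b)    ≈⟨ toℚᵘ-homo-* (ι a) (ι b) ⟨
  toℚᵘ (ι a ℚ.* ι b)            ∎)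
  where open ℚᵘ.≃-Reasoning

ι-neg : ∀ a → ι (ℤ.- a) ≡ ℚ.- ι a
ι-neg a = begin
  ι (ℤ.- a)            ≡⟨ cong ι (ℤ.-1*i≡-i a) ⟨
  ι (ℤ.-1ℤ ℤ.* a)      ≡⟨ ι-* ℤ.-1ℤ a ⟩
  ι ℤ.-1ℤ ℚ.* ι a      ≡⟨ solve 1 (λ x → con (ι ℤ.-1ℤ) :* x := :- x) refl (ι a) ⟩
  ℚ.- ι a              ∎
  where open ≡-Reasoning

ι-injective : ∀ {a b} → ι a ≡ ι b → a ≡ b
ι-injective {a} {b} ιa≡ιb with ℚᵘ.≃-trans (ℚᵘ.≃-sym (toℚᵘ-ι a)) (ℚᵘ.≃-trans (ℚᵘ.≃-reflexive (cong toℚᵘ ιa≡ιb)) (toℚᵘ-ι b))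
... | *≡* a*1≡b*1 = trans (sym (ℤ.*-identityʳ a)) (trans a*1≡b*1 (ℤ.*-identityʳ b))

record Quarters (a : ℤ) (r : ℚ) : Set where
  constructor quarters
  field
    4r≡a : r ℚ.* ι (+ 4) ≡ ι a

quarters-0 : Quarters (+ 0) 0ℚ
quarters-0 = quarters refl

quarters-+ : ∀ {a b r s} → Quarters a r → Quarters b s → Quarters (a ℤ.+ b) (r ℚ.+ s)
quarters-+ {a} {b} {r} {s} (quarters 4r≡a) (quarters 4s≡b) = quarters (begin
  (r ℚ.+ s) ℚ.* ι (+ 4)             ≡⟨ solve 2 (λ r s → (r :+ s) :* con (ι (+ 4)) := r :* con (ι (+ 4)) :+ s :* con (ι (+ 4))) refl r s ⟩
  r ℚ.* ι (+ 4) ℚ.+ s ℚ.* ι (+ 4)   ≡⟨ cong₂ ℚ._+_ 4r≡a 4s≡b ⟩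
  ι a ℚ.+ ι b                       ≡⟨ ι-+ a b ⟨
  ι (a ℤ.+ b)                       ∎)
  where open ≡-Reasoning

quarters-neg : ∀ {a r} → Quarters a r → Quarters (ℤ.- a) (ℚ.- r)
quarters-neg {a} {r} (quarters 4r≡a) = quarters (begin
  ℚ.- r ℚ.* ι (+ 4)      ≡⟨ solve 1 (λ r → (:- r) :* con (ι (+ 4)) := :- (r :* con (ι (+ 4)))) refl r ⟩
  ℚ.- (r ℚ.* ι (+ 4))    ≡⟨ cong ℚ.-_ 4r≡a ⟩
  ℚ.- ι a                ≡⟨ ι-neg a ⟨
  ι (ℤ.- a)              ∎)
  where open ≡-Reasoning

quarters-- : ∀ {a b r s} → Quarters a r → Quarters b s → Quarters (a ℤ.- b) (r ℚ.- s)
quarters-- 4r≡a 4s≡b = quarters-+ 4r≡a (quarters-neg 4s≡b)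

quarters-double : ∀ {a r} → Quarters a r → Quarters (a ℤ.+ a) (ℕtoℚ 2 ℚ.* r)
quarters-double {a} {r} 4r≡a =
  subst (Quarters (a ℤ.+ a)) (solve 1 (λ r → r :+ r := con (ι (+ 2)) :* r) refl r) (quarters-+ 4r≡a 4r≡a)

quarters-integral : ∀ {a r} k → Quarters a r → r ≡ ι k → a ≡ k ℤ.* + 4
quarters-integral {a} {r} k (quarters 4r≡a) r≡ιk = ι-injective (begin
  ι a                 ≡⟨ 4r≡a ⟨
  r ℚ.* ι (+ 4)       ≡⟨ cong (ℚ._* ι (+ 4)) r≡ιk ⟩
  ι k ℚ.* ι (+ 4)     ≡⟨ ι-* k (+ 4) ⟨
  ι (k ℤ.* + 4)       ∎)
  where open ≡-Reasoning

quarters-of-multiple : ∀ {a r} k → Quarters a r → a ≡ k ℤ.* + 4 → r ≡ ι k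
quarters-of-multiple {a} {r} k (quarters 4r≡a) a≡k*4 = begin
  r                               ≡⟨ solve 1 (λ r → r := r :* con (ι (+ 4)) :* con (+ 1 / 4)) refl r ⟩
  r ℚ.* ι (+ 4) ℚ.* (+ 1 / 4)     ≡⟨ cong (ℚ._* (+ 1 / 4)) (trans 4r≡a (trans (cong ι a≡k*4) (ι-* k (+ 4)))) ⟩
  ι k ℚ.* ι (+ 4) ℚ.* (+ 1 / 4)   ≡⟨ solve 1 (λ x → x :* con (ι (+ 4)) :* con (+ 1 / 4) := x) refl (ι k) ⟩
  ι k                             ∎
  where open ≡-Reasoning

a≡b+[a-b] : ∀ a b → a ≡ b ℤ.+ (a ℤ.- b)
a≡b+[a-b] = solve-∀

≡[modℤ]⇒[]≡ : ∀ {a b r s} → Quarters a r → Quarters b s → r ≡[modℤ] s → [ a ] ≡ [ b ]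
≡[modℤ]⇒[]≡ {a} {b} 4r≡a 4s≡b (k , r-s≡ιk) = begin
  [ a ]                        ≡⟨ cong [_] (a≡b+[a-b] a b) ⟩
  [ b ℤ.+ (a ℤ.- b) ]          ≡⟨ [+] b (a ℤ.- b) ⟩
  [ b ] +₄ [ a ℤ.- b ]         ≡⟨ cong (λ t → [ b ] +₄ [ t ]) (quarters-integral k (quarters-- 4r≡a 4s≡b) r-s≡ιk) ⟩
  [ b ] +₄ [ k ℤ.* + 4 ]       ≡⟨ cong ([ b ] +₄_) ([k*4]≡0 k) ⟩
  [ b ] +₄ 0₄                  ≡⟨ +₄-identityʳ [ b ] ⟩
  [ b ]                        ∎
  where open ≡-Reasoning

[]≡⇒≡[modℤ] : ∀ {a b r s} → Quarters a r → Quarters b s → [ a ] ≡ [ b ] → r ≡[modℤ] s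
[]≡⇒≡[modℤ] {a} {b} 4r≡a 4s≡b [a]≡[b] =
  let k , a-b≡k*4 = [a]≡0⇒a≡k*4 (a ℤ.- b) [a-b]≡0
  in k , quarters-of-multiple k (quarters-- 4r≡a 4s≡b) a-b≡k*4
  where
  open ≡-Reasoning
  [a-b]≡0 : [ a ℤ.- b ] ≡ 0₄
  [a-b]≡0 = +₄-cancelˡ [ b ] [ a ℤ.- b ] 0₄ (begin
    [ b ] +₄ [ a ℤ.- b ]   ≡⟨ [+] b (a ℤ.- b) ⟨
    [ b ℤ.+ (a ℤ.- b) ]    ≡⟨ cong [_] (a≡b+[a-b] a b) ⟨
    [ a ]                  ≡⟨ [a]≡[b] ⟩
    [ b ]                  ≡⟨ +₄-identityʳ [ b ] ⟨
    [ b ] +₄ 0₄            ∎)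

≡[modℤ]-sym : ∀ {r s} → r ≡[modℤ] s → s ≡[modℤ] r
≡[modℤ]-sym {r} {s} (k , r-s≡ιk) = ℤ.- k , (begin
  s ℚ.- r          ≡⟨ solve 2 (λ r s → s :- r := :- (r :- s)) refl r s ⟩
  ℚ.- (r ℚ.- s)    ≡⟨ cong ℚ.-_ r-s≡ιk ⟩
  ℚ.- ι k          ≡⟨ ι-neg k ⟨
  ι (ℤ.- k)        ∎)
  where open ≡-Reasoning

≡[modℤ]⇒2*≡[mod2ℤ] : ∀ {r s} → r ≡[modℤ] s → (ℕtoℚ 2 ℚ.* r) ≡[mod2ℤ] (ℕtoℚ 2 ℚ.* s)
≡[modℤ]⇒2*≡[mod2ℤ] {r} {s} (k , r-s≡ιk) = k , (begin
  ℕtoℚ 2 ℚ.* r ℚ.- ℕtoℚ 2 ℚ.* s   ≡⟨ solve 2 (λ r s → con (ι (+ 2)) :* r :- con (ι (+ 2)) :* s := (r :- s) :* con (ι (+ 2))) refl r s ⟩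
  (r ℚ.- s) ℚ.* ι (+ 2)           ≡⟨ cong (ℚ._* ι (+ 2)) r-s≡ιk ⟩
  ι k ℚ.* ι (+ 2)                 ≡⟨ ι-* k (+ 2) ⟨
  ι (k ℤ.* + 2)                   ∎)
  where open ≡-Reasoning

2*≡[mod2ℤ]⇒≡[modℤ] : ∀ {r s} → (ℕtoℚ 2 ℚ.* r) ≡[mod2ℤ] (ℕtoℚ 2 ℚ.* s) → r ≡[modℤ] s
2*≡[mod2ℤ]⇒≡[modℤ] {r} {s} (k , 2r-2s≡ι[k*2]) = k , (begin
  r ℚ.- s                                          ≡⟨ solve 2 (λ r s → r :- s := (con (ι (+ 2)) :* r :- con (ι (+ 2)) :* s) :* con (+ 1 / 2)) refl r s ⟩
  (ℕtoℚ 2 ℚ.* r ℚ.- ℕtoℚ 2 ℚ.* s) ℚ.* (+ 1 / 2)    ≡⟨ cong (ℚ._* (+ 1 / 2)) (trans 2r-2s≡ι[k*2] (ι-* k (+ 2))) ⟩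
  ι k ℚ.* ι (+ 2) ℚ.* (+ 1 / 2)                    ≡⟨ solve 1 (λ x → x :* con (ι (+ 2)) :* con (+ 1 / 2) := x) refl (ι k) ⟩
  ι k                                              ∎)
  where open ≡-Reasoning

-- The 𝔽₂-vector space E₂ n

module _ {n : ℕ} where

  ⊕-comm : (x y : E₂ n) → x ⊕ y ≡ y ⊕ x
  ⊕-comm = zipWith-comm xor-comm

  ⊕-assoc : (x y z : E₂ n) → (x ⊕ y) ⊕ z ≡ x ⊕ (y ⊕ z)
  ⊕-assoc = zipWith-assoc xor-assoc

  ⊕-identityˡ : (x : E₂ n) → 0ᴱ ⊕ x ≡ x
  ⊕-identityˡ = zipWith-identityˡ xor-identityˡ

  ⊕-identityʳ : (x : E₂ n) → x ⊕ 0ᴱ ≡ x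
  ⊕-identityʳ = zipWith-identityʳ xor-identityʳ

⊕-self : ∀ {n} (x : E₂ n) → x ⊕ x ≡ 0ᴱ
⊕-self []      = refl
⊕-self (a ∷ x) = cong₂ _∷_ (xor-same a) (⊕-self x)

module _ {n : ℕ} where

  ⊕-cancelˡ : (x y : E₂ n) → x ⊕ (x ⊕ y) ≡ y
  ⊕-cancelˡ x y = begin
    x ⊕ (x ⊕ y)  ≡⟨ ⊕-assoc x x y ⟨
    (x ⊕ x) ⊕ y  ≡⟨ cong (_⊕ y) (⊕-self x) ⟩
    0ᴱ ⊕ y       ≡⟨ ⊕-identityˡ y ⟩
    y            ∎
    where open ≡-Reasoning

  ⊕-cancelʳ : (x y : E₂ n) → (x ⊕ y) ⊕ y ≡ x
  ⊕-cancelʳ x y = begin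
    (x ⊕ y) ⊕ y  ≡⟨ ⊕-assoc x y y ⟩
    x ⊕ (y ⊕ y)  ≡⟨ cong (x ⊕_) (⊕-self y) ⟩
    x ⊕ 0ᴱ       ≡⟨ ⊕-identityʳ x ⟩
    x            ∎
    where open ≡-Reasoning

  ⊕≡0⇒≡ : {x y : E₂ n} → x ⊕ y ≡ 0ᴱ → x ≡ y
  ⊕≡0⇒≡ {x} {y} x⊕y≡0 = trans (sym (⊕-cancelʳ x y)) (trans (cong (_⊕ y) x⊕y≡0) (⊕-identityˡ y))

  ⊕-right-comm : (x y z : E₂ n) → (x ⊕ y) ⊕ z ≡ (x ⊕ z) ⊕ y
  ⊕-right-comm x y z = trans (⊕-assoc x y z) (trans (cong (x ⊕_) (⊕-comm y z)) (sym (⊕-assoc x z y)))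

  ⊕-interchange : (a b c d : E₂ n) → (a ⊕ b) ⊕ (c ⊕ d) ≡ (a ⊕ c) ⊕ (b ⊕ d)
  ⊕-interchange a b c d = begin
    (a ⊕ b) ⊕ (c ⊕ d)  ≡⟨ ⊕-assoc a b (c ⊕ d) ⟩
    a ⊕ (b ⊕ (c ⊕ d))  ≡⟨ cong (a ⊕_) (⊕-assoc b c d) ⟨
    a ⊕ ((b ⊕ c) ⊕ d)  ≡⟨ cong (λ t → a ⊕ (t ⊕ d)) (⊕-comm b c) ⟩
    a ⊕ ((c ⊕ b) ⊕ d)  ≡⟨ cong (a ⊕_) (⊕-assoc c b d) ⟩
    a ⊕ (c ⊕ (b ⊕ d))  ≡⟨ ⊕-assoc a c (b ⊕ d) ⟨
    (a ⊕ c) ⊕ (b ⊕ d)  ∎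
    where open ≡-Reasoning

  infixr 25 _⊙_

  _⊙_ : Bool → E₂ n → E₂ n
  true  ⊙ v = v
  false ⊙ v = 0ᴱ

  ⊙-xor : ∀ a b v → (a xor b) ⊙ v ≡ a ⊙ v ⊕ b ⊙ v
  ⊙-xor false b     v = sym (⊕-identityˡ (b ⊙ v))
  ⊙-xor true  false v = sym (⊕-identityʳ v)
  ⊙-xor true  true  v = sym (⊕-self v)

  InSpan : List (E₂ n) → E₂ n → Set
  InSpan []       x = x ≡ 0ᴱ
  InSpan (w ∷ ws) x = InSpan ws x ⊎ InSpan ws (x ⊕ w)

  x∉span[x⊕y,c] : ∀ {c x y : E₂ n} → x ≢ 0ᴱ → y ≢ 0ᴱ → x ≢ c → y ≢ c → ¬ InSpan (x ⊕ y ∷ c ∷ []) x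
  x∉span[x⊕y,c] {c} {x} {y} x≢0 y≢0 x≢c y≢c = λ
    { (inj₁ (inj₁ x≡0))         → x≢0 x≡0
    ; (inj₁ (inj₂ x⊕c≡0))       → x≢c (⊕≡0⇒≡ x⊕c≡0)
    ; (inj₂ (inj₁ x⊕[x⊕y]≡0))   → y≢0 (trans (sym (⊕-cancelˡ x y)) x⊕[x⊕y]≡0)
    ; (inj₂ (inj₂ x⊕[x⊕y]⊕c≡0)) → y≢c (⊕≡0⇒≡ (trans (cong (_⊕ c) (sym (⊕-cancelˡ x y))) x⊕[x⊕y]⊕c≡0))
    }

any? : ∀ {n p} {P : E₂ n → Set p} → Decidable P → Dec (∃ P)
any? {zero}  P? = Dec.map′ ([] ,_) (λ { ([] , p) → p }) (P? [])
any? {suc n} P? = Dec.map′ from-⊎ to-⊎ (any? (λ v → P? (false ∷ v)) ⊎-dec any? (λ v → P? (true ∷ v)))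
  where
  from-⊎ = λ { (inj₁ (v , p)) → false ∷ v , p ; (inj₂ (v , p)) → true ∷ v , p }
  to-⊎   = λ { (false ∷ v , p) → inj₁ (v , p) ; (true ∷ v , p) → inj₂ (v , p) }

-- ℤ/4-valued quadratic refinements of 𝔽₂-bilinear forms

record QuadraticRefinement (n : ℕ) : Set where
  field
    Q               : E₂ n → ℤ₄
    β               : E₂ n → E₂ n → Bool
    Q-⊕             : ∀ x y → Q (x ⊕ y) ≡ Q x +₄ Q y +₄ twice (β x y)
    β-⊕ˡ            : ∀ x y z → β (x ⊕ y) z ≡ β x z xor β y z
    β-nondegenerate : ∀ x → (∀ y → β x y ≡ false) → x ≡ 0ᴱ

  Characteristic : E₂ n → Set
  Characteristic c = ∀ z → β z c ≡ β z z

record Isometry {n : ℕ} (R : QuadraticRefinement n) : Set where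
  field
    bijection : E₂ n ↔ E₂ n
  apply : E₂ n → E₂ n
  apply = Inverse.to bijection
  field
    ⊕-homo      : ∀ x y → apply (x ⊕ y) ≡ apply x ⊕ apply y
    preserves-Q : ∀ x → QuadraticRefinement.Q R (apply x) ≡ QuadraticRefinement.Q R x

module QuadraticRefinementProperties {n : ℕ} (R : QuadraticRefinement n) where
  open QuadraticRefinement R

  Moves : E₂ n → E₂ n → Set
  Moves x y = Σ (Isometry R) λ g → Isometry.apply g x ≡ y

  infixr 9 _∘ᴵ_

  _∘ᴵ_ : Isometry R → Isometry R → Isometry R
  g ∘ᴵ f = record
    { bijection   = G.bijection ↔-∘ F.bijection
    ; ⊕-homo      = λ x y → trans (cong G.apply (F.⊕-homo x y)) (G.⊕-homo (F.apply x) (F.apply y))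
    ; preserves-Q = λ x → trans (G.preserves-Q (F.apply x)) (F.preserves-Q x)
    }
    where
    module G = Isometry g
    module F = Isometry f

  β-0ˡ : ∀ y → β 0ᴱ y ≡ false
  β-0ˡ y = begin
    β 0ᴱ y                ≡⟨ cong (λ w → β w y) (⊕-self 0ᴱ) ⟨
    β (0ᴱ ⊕ 0ᴱ) y         ≡⟨ β-⊕ˡ 0ᴱ 0ᴱ y ⟩
    β 0ᴱ y xor β 0ᴱ y     ≡⟨ xor-same (β 0ᴱ y) ⟩
    false                 ∎
    where open ≡-Reasoning

  Q-0 : Q 0ᴱ ≡ 0₄
  Q-0 = +₄-cancelˡ (Q 0ᴱ) (Q 0ᴱ) 0₄ (begin
    Q 0ᴱ +₄ Q 0ᴱ                    ≡⟨ +₄-identityʳ _ ⟨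
    Q 0ᴱ +₄ Q 0ᴱ +₄ twice false     ≡⟨ cong (λ b → Q 0ᴱ +₄ Q 0ᴱ +₄ twice b) (β-0ˡ 0ᴱ) ⟨
    Q 0ᴱ +₄ Q 0ᴱ +₄ twice (β 0ᴱ 0ᴱ) ≡⟨ Q-⊕ 0ᴱ 0ᴱ ⟨
    Q (0ᴱ ⊕ 0ᴱ)                     ≡⟨ cong Q (⊕-self 0ᴱ) ⟩
    Q 0ᴱ                            ≡⟨ +₄-identityʳ (Q 0ᴱ) ⟨
    Q 0ᴱ +₄ 0₄                      ∎)
    where open ≡-Reasoning

  β-sym : ∀ x y → β x y ≡ β y x
  β-sym x y = twice-injective (+₄-cancelˡ (Q x +₄ Q y) _ _ (begin
    Q x +₄ Q y +₄ twice (β x y)  ≡⟨ Q-⊕ x y ⟨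
    Q (x ⊕ y)                    ≡⟨ cong Q (⊕-comm x y) ⟩
    Q (y ⊕ x)                    ≡⟨ Q-⊕ y x ⟩
    Q y +₄ Q x +₄ twice (β y x)  ≡⟨ cong (_+₄ twice (β y x)) (+₄-comm (Q y) (Q x)) ⟩
    Q x +₄ Q y +₄ twice (β y x)  ∎))
    where open ≡-Reasoning

  β-⊕ʳ : ∀ z x y → β z (x ⊕ y) ≡ β z x xor β z y
  β-⊕ʳ z x y = trans (β-sym z (x ⊕ y)) (trans (β-⊕ˡ x y z) (cong₂ _xor_ (β-sym x z) (β-sym y z)))

  β-⊙ˡ : ∀ b w z → β (b ⊙ w) z ≡ b ∧ β w z
  β-⊙ˡ true  w z = refl
  β-⊙ˡ false w z = β-0ˡ z

  β-⊙ʳ : ∀ z b w → β z (b ⊙ w) ≡ b ∧ β z w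
  β-⊙ʳ z b w = trans (β-sym z (b ⊙ w)) (trans (β-⊙ˡ b w z) (cong (b ∧_) (β-sym w z)))

  Q-double : ∀ x → Q x +₄ Q x ≡ twice (β x x)
  Q-double x = begin
    Q x +₄ Q x                                     ≡⟨ +₄-identityʳ _ ⟨
    Q x +₄ Q x +₄ 0₄                               ≡⟨ cong (Q x +₄ Q x +₄_) (twice+twice≡0 (β x x)) ⟨
    Q x +₄ Q x +₄ (twice (β x x) +₄ twice (β x x)) ≡⟨ +₄-assoc (Q x +₄ Q x) _ _ ⟨
    Q x +₄ Q x +₄ twice (β x x) +₄ twice (β x x)   ≡⟨ cong (_+₄ twice (β x x)) (Q-⊕ x x) ⟨
    Q (x ⊕ x) +₄ twice (β x x)                     ≡⟨ cong (λ w → Q w +₄ twice (β x x)) (⊕-self x) ⟩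
    Q 0ᴱ +₄ twice (β x x)                          ≡⟨ cong (_+₄ twice (β x x)) Q-0 ⟩
    twice (β x x)                                  ∎
    where open ≡-Reasoning

  β-self≡false : ∀ {x} → Q x ≡ 0₄ ⊎ Q x ≡ 2₄ → β x x ≡ false
  β-self≡false {x} Qx≡0∨2 = twice-injective (trans (sym (Q-double x)) (2Q≡0 Qx≡0∨2))
    where
    2Q≡0 : Q x ≡ 0₄ ⊎ Q x ≡ 2₄ → Q x +₄ Q x ≡ 0₄
    2Q≡0 (inj₁ Qx≡0) = cong (λ t → t +₄ t) Qx≡0
    2Q≡0 (inj₂ Qx≡2) = cong (λ t → t +₄ t) Qx≡2

  Q-⊕-of-equal : ∀ {x y} → Q x ≡ Q y → Q (x ⊕ y) ≡ twice (β x (x ⊕ y))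
  Q-⊕-of-equal {x} {y} Qx≡Qy = begin
    Q (x ⊕ y)                          ≡⟨ Q-⊕ x y ⟩
    Q x +₄ Q y +₄ twice (β x y)        ≡⟨ cong (λ t → Q x +₄ t +₄ twice (β x y)) Qx≡Qy ⟨
    Q x +₄ Q x +₄ twice (β x y)        ≡⟨ cong (_+₄ twice (β x y)) (Q-double x) ⟩
    twice (β x x) +₄ twice (β x y)     ≡⟨ twice-xor (β x x) (β x y) ⟨
    twice (β x x xor β x y)            ≡⟨ cong twice (β-⊕ʳ x x y) ⟨
    twice (β x (x ⊕ y))                ∎
    where open ≡-Reasoning

  Q-⊕-shear : ∀ {z w} → Q w ≡ twice (β z w) → Q (z ⊕ w) ≡ Q z
  Q-⊕-shear {z} {w} Qw≡2βzw = begin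
    Q (z ⊕ w)                  ≡⟨ Q-⊕ z w ⟩
    Q z +₄ Q w +₄ t            ≡⟨ cong (λ s → Q z +₄ s +₄ t) Qw≡2βzw ⟩
    Q z +₄ t +₄ t              ≡⟨ +₄-assoc (Q z) t t ⟩
    Q z +₄ (t +₄ t)            ≡⟨ cong (Q z +₄_) (twice+twice≡0 (β z w)) ⟩
    Q z +₄ 0₄                  ≡⟨ +₄-identityʳ (Q z) ⟩
    Q z                        ∎
    where
    open ≡-Reasoning
    t = twice (β z w)

  -- Transvections and Siegel transformations are both of this form.
  shear : (δ : E₂ n → E₂ n) →
          (∀ x y → δ (x ⊕ y) ≡ δ x ⊕ δ y) →
          (∀ z → δ (δ z) ≡ 0ᴱ) →
          (∀ z → Q (δ z) ≡ twice (β z (δ z))) →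
          Isometry R
  shear δ δ-⊕ δ²≡0 Q∘δ = record
    { bijection   = mk↔ₛ′ s s s-involutive s-involutive
    ; ⊕-homo      = λ x y → trans (cong ((x ⊕ y) ⊕_) (δ-⊕ x y)) (⊕-interchange x y (δ x) (δ y))
    ; preserves-Q = λ z → Q-⊕-shear (Q∘δ z)
    }
    where
    open ≡-Reasoning
    s : E₂ n → E₂ n
    s z = z ⊕ δ z
    s-involutive : ∀ z → s (s z) ≡ z
    s-involutive z = begin
      (z ⊕ δ z) ⊕ δ (z ⊕ δ z)     ≡⟨ cong ((z ⊕ δ z) ⊕_) (δ-⊕ z (δ z)) ⟩
      (z ⊕ δ z) ⊕ (δ z ⊕ δ (δ z)) ≡⟨ cong (λ w → (z ⊕ δ z) ⊕ (δ z ⊕ w)) (δ²≡0 z) ⟩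
      (z ⊕ δ z) ⊕ (δ z ⊕ 0ᴱ)      ≡⟨ cong ((z ⊕ δ z) ⊕_) (⊕-identityʳ (δ z)) ⟩
      (z ⊕ δ z) ⊕ δ z             ≡⟨ ⊕-cancelʳ z (δ z) ⟩
      z                           ∎

  transvection : ∀ v → Q v ≡ 2₄ → Isometry R
  transvection v Qv≡2 = shear (λ z → β z v ⊙ v) δ-⊕ δ²≡0 Q∘δ
    where
    βvv≡false : β v v ≡ false
    βvv≡false = β-self≡false (inj₂ Qv≡2)
    δ-⊕ : ∀ x y → β (x ⊕ y) v ⊙ v ≡ β x v ⊙ v ⊕ β y v ⊙ v
    δ-⊕ x y = trans (cong (_⊙ v) (β-⊕ˡ x y v)) (⊙-xor (β x v) (β y v) v)
    δ²≡0 : ∀ z → β (β z v ⊙ v) v ⊙ v ≡ 0ᴱ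
    δ²≡0 z = cong (_⊙ v) (trans (β-⊙ˡ (β z v) v v) (trans (cong (β z v ∧_) βvv≡false) (∧-zeroʳ (β z v))))
    Q-⊙ : ∀ b → Q (b ⊙ v) ≡ twice b
    Q-⊙ true  = Qv≡2
    Q-⊙ false = Q-0
    Q∘δ : ∀ z → Q (β z v ⊙ v) ≡ twice (β z (β z v ⊙ v))
    Q∘δ z = trans (Q-⊙ (β z v)) (cong twice (sym (trans (β-⊙ʳ z (β z v) v) (∧-idem (β z v)))))

  transvection-apply : ∀ {v} (Qv≡2 : Q v ≡ 2₄) {x} → β x v ≡ true →
                       Isometry.apply (transvection v Qv≡2) x ≡ x ⊕ v
  transvection-apply {v} _ {x} βxv≡true = cong (λ b → x ⊕ b ⊙ v) βxv≡true

  siegel : ∀ u v → Q u ≡ 0₄ → Q v ≡ 0₄ → β u v ≡ false → Isometry R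
  siegel u v Qu≡0 Qv≡0 βuv≡false = shear δ δ-⊕ δ²≡0 Q∘δ
    where
    open ≡-Reasoning
    δ : E₂ n → E₂ n
    δ z = β z u ⊙ v ⊕ β z v ⊙ u
    βvu≡false : β v u ≡ false
    βvu≡false = trans (β-sym v u) βuv≡false
    Q-⊙ : ∀ {w} → Q w ≡ 0₄ → ∀ b → Q (b ⊙ w) ≡ 0₄
    Q-⊙ Qw≡0 true  = Qw≡0
    Q-⊙ Qw≡0 false = Q-0
    δ-⊕ : ∀ x y → δ (x ⊕ y) ≡ δ x ⊕ δ y
    δ-⊕ x y = begin
      β (x ⊕ y) u ⊙ v ⊕ β (x ⊕ y) v ⊙ u
        ≡⟨ cong₂ (λ a b → a ⊙ v ⊕ b ⊙ u) (β-⊕ˡ x y u) (β-⊕ˡ x y v) ⟩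
      (β x u xor β y u) ⊙ v ⊕ (β x v xor β y v) ⊙ u
        ≡⟨ cong₂ _⊕_ (⊙-xor (β x u) (β y u) v) (⊙-xor (β x v) (β y v) u) ⟩
      (β x u ⊙ v ⊕ β y u ⊙ v) ⊕ (β x v ⊙ u ⊕ β y v ⊙ u)
        ≡⟨ ⊕-interchange (β x u ⊙ v) (β y u ⊙ v) (β x v ⊙ u) (β y v ⊙ u) ⟩
      δ x ⊕ δ y ∎
    β-⊙v⊕⊙u : ∀ a b w → β v w ≡ false → β u w ≡ false → β (a ⊙ v ⊕ b ⊙ u) w ≡ false
    β-⊙v⊕⊙u a b w βvw≡false βuw≡false = begin
      β (a ⊙ v ⊕ b ⊙ u) w               ≡⟨ β-⊕ˡ (a ⊙ v) (b ⊙ u) w ⟩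
      β (a ⊙ v) w xor β (b ⊙ u) w       ≡⟨ cong₂ _xor_ (β-⊙ˡ a v w) (β-⊙ˡ b u w) ⟩
      (a ∧ β v w) xor (b ∧ β u w)       ≡⟨ cong₂ (λ s t → (a ∧ s) xor (b ∧ t)) βvw≡false βuw≡false ⟩
      (a ∧ false) xor (b ∧ false)       ≡⟨ cong₂ _xor_ (∧-zeroʳ a) (∧-zeroʳ b) ⟩
      false                             ∎
    δ²≡0 : ∀ z → δ (δ z) ≡ 0ᴱ
    δ²≡0 z = trans (cong₂ (λ a b → a ⊙ v ⊕ b ⊙ u)
                     (β-⊙v⊕⊙u (β z u) (β z v) u βvu≡false (β-self≡false (inj₁ Qu≡0)))
                     (β-⊙v⊕⊙u (β z u) (β z v) v (β-self≡false (inj₁ Qv≡0)) βuv≡false))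
                   (⊕-identityˡ 0ᴱ)
    β-⊙v-⊙u : ∀ a b → β (a ⊙ v) (b ⊙ u) ≡ false
    β-⊙v-⊙u a b = begin
      β (a ⊙ v) (b ⊙ u)      ≡⟨ β-⊙ˡ a v (b ⊙ u) ⟩
      a ∧ β v (b ⊙ u)        ≡⟨ cong (a ∧_) (β-⊙ʳ v b u) ⟩
      a ∧ (b ∧ β v u)        ≡⟨ cong (λ t → a ∧ (b ∧ t)) βvu≡false ⟩
      a ∧ (b ∧ false)        ≡⟨ cong (a ∧_) (∧-zeroʳ b) ⟩
      a ∧ false              ≡⟨ ∧-zeroʳ a ⟩
      false                  ∎
    βzδz≡false : ∀ z → β z (δ z) ≡ false
    βzδz≡false z = begin
      β z (β z u ⊙ v ⊕ β z v ⊙ u)                 ≡⟨ β-⊕ʳ z (β z u ⊙ v) (β z v ⊙ u) ⟩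
      β z (β z u ⊙ v) xor β z (β z v ⊙ u)         ≡⟨ cong₂ _xor_ (β-⊙ʳ z (β z u) v) (β-⊙ʳ z (β z v) u) ⟩
      (β z u ∧ β z v) xor (β z v ∧ β z u)         ≡⟨ cong ((β z u ∧ β z v) xor_) (∧-comm (β z v) (β z u)) ⟩
      (β z u ∧ β z v) xor (β z u ∧ β z v)         ≡⟨ xor-same (β z u ∧ β z v) ⟩
      false                                       ∎
    Q∘δ : ∀ z → Q (δ z) ≡ twice (β z (δ z))
    Q∘δ z = begin
      Q (β z u ⊙ v ⊕ β z v ⊙ u)
        ≡⟨ Q-⊕ (β z u ⊙ v) (β z v ⊙ u) ⟩
      Q (β z u ⊙ v) +₄ Q (β z v ⊙ u) +₄ twice (β (β z u ⊙ v) (β z v ⊙ u))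
        ≡⟨ cong₂ (λ s t → s +₄ t +₄ twice (β (β z u ⊙ v) (β z v ⊙ u))) (Q-⊙ Qv≡0 (β z u)) (Q-⊙ Qu≡0 (β z v)) ⟩
      twice (β (β z u ⊙ v) (β z v ⊙ u))
        ≡⟨ cong twice (β-⊙v-⊙u (β z u) (β z v)) ⟩
      twice false
        ≡⟨ cong twice (βzδz≡false z) ⟨
      twice (β z (δ z)) ∎

  siegel-apply : ∀ {u v} (Qu≡0 : Q u ≡ 0₄) (Qv≡0 : Q v ≡ 0₄) (βuv≡false : β u v ≡ false) {x} →
                 β x u ≡ true → β x v ≡ false →
                 Isometry.apply (siegel u v Qu≡0 Qv≡0 βuv≡false) x ≡ x ⊕ v
  siegel-apply {u} {v} _ _ _ {x} βxu≡true βxv≡false =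
    trans (cong₂ (λ a b → x ⊕ (a ⊙ v ⊕ b ⊙ u)) βxu≡true βxv≡false) (cong (x ⊕_) (⊕-identityʳ v))

  Annihilates : E₂ n → List (E₂ n) → Set
  Annihilates u = All (λ w → β u w ≡ false)

  -- A witness u₁ that fails on w is corrected by a witness u₂ for x ⊕ w.
  separate : ∀ ws x → ¬ InSpan ws x → Σ (E₂ n) λ u → β u x ≡ true × Annihilates u ws
  separate [] x x≢0 with any? (λ u → β u x ≟ᴮ true)
  ... | yes (u , βux≡true) = u , βux≡true , []
  ... | no ∄u = contradiction (β-nondegenerate x λ y → trans (β-sym x y) (¬-not λ βyx → ∄u (y , βyx))) x≢0
  separate (w ∷ ws) x x∉ with separate ws x (λ x∈ → x∉ (inj₁ x∈)) | separate ws (x ⊕ w) (λ x⊕w∈ → x∉ (inj₂ x⊕w∈))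
  ... | u₁ , βu₁x , u₁⊥ws | u₂ , βu₂[x⊕w] , u₂⊥ws =
    combine u₁ u₂ βu₁x (trans (sym (β-⊕ʳ u₂ x w)) βu₂[x⊕w]) u₁⊥ws u₂⊥ws
    where
    combine : ∀ u₁ u₂ → β u₁ x ≡ true → β u₂ x xor β u₂ w ≡ true → Annihilates u₁ ws → Annihilates u₂ ws →
              Σ (E₂ n) λ u → β u x ≡ true × Annihilates u (w ∷ ws)
    combine u₁ u₂ βu₁x _ u₁⊥ws u₂⊥ws with β u₁ w in βu₁w | β u₂ x in βu₂x | β u₂ w in βu₂w
    ... | false | _     | _     = u₁ , βu₁x , βu₁w ∷ u₁⊥ws
    ... | true  | true  | false = u₂ , βu₂x , βu₂w ∷ u₂⊥ws
    ... | true  | false | true  = u₁ ⊕ u₂ ,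
                                  trans (β-⊕ˡ u₁ u₂ x) (cong₂ _xor_ βu₁x βu₂x) ,
                                  trans (β-⊕ˡ u₁ u₂ w) (cong₂ _xor_ βu₁w βu₂w) ∷
                                  All.zipWith (λ (p , q) → trans (β-⊕ˡ u₁ u₂ _) (cong₂ _xor_ p q)) (u₁⊥ws , u₂⊥ws)

  moves-by-transvection : ∀ {x y} → Q x ≡ Q y → β x (x ⊕ y) ≡ true → Moves x y
  moves-by-transvection {x} {y} Qx≡Qy βx[x⊕y]≡true =
    transvection (x ⊕ y) Q[x⊕y]≡2 ,
    trans (transvection-apply Q[x⊕y]≡2 βx[x⊕y]≡true) (⊕-cancelˡ x y)
    where
    Q[x⊕y]≡2 : Q (x ⊕ y) ≡ 2₄
    Q[x⊕y]≡2 = trans (Q-⊕-of-equal Qx≡Qy) (cong twice βx[x⊕y]≡true)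

  moves-via : ∀ {x y} u → Q x ≡ Q y → β x (x ⊕ y) ≡ false →
              β u x ≡ true → β u (x ⊕ y) ≡ false → Q u ≡ 0₄ ⊎ Q u ≡ 2₄ → Moves x y
  moves-via {x} {y} u Qx≡Qy βx[x⊕y]≡false βux≡true βu[x⊕y]≡false (inj₁ Qu≡0) =
    siegel u (x ⊕ y) Qu≡0 Q[x⊕y]≡0 βu[x⊕y]≡false ,
    trans (siegel-apply Qu≡0 Q[x⊕y]≡0 βu[x⊕y]≡false (trans (β-sym x u) βux≡true) βx[x⊕y]≡false) (⊕-cancelˡ x y)
    where
    Q[x⊕y]≡0 : Q (x ⊕ y) ≡ 0₄
    Q[x⊕y]≡0 = trans (Q-⊕-of-equal Qx≡Qy) (cong twice βx[x⊕y]≡false)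
  moves-via {x} {y} u Qx≡Qy βx[x⊕y]≡false βux≡true βu[x⊕y]≡false (inj₂ Qu≡2) =
    let g , g[x⊕u]≡y = moves-by-transvection Q[x⊕u]≡Qy β[x⊕u][x⊕u⊕y]≡true
    in g ∘ᴵ transvection u Qu≡2 , trans (cong (Isometry.apply g) (transvection-apply Qu≡2 βxu≡true)) g[x⊕u]≡y
    where
    open ≡-Reasoning
    βxu≡true : β x u ≡ true
    βxu≡true = trans (β-sym x u) βux≡true
    Q[x⊕u]≡Qy : Q (x ⊕ u) ≡ Q y
    Q[x⊕u]≡Qy = trans (Q-⊕-shear (trans Qu≡2 (cong twice (sym βxu≡true)))) Qx≡Qy
    β[x⊕u][x⊕u⊕y]≡true : β (x ⊕ u) ((x ⊕ u) ⊕ y) ≡ true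
    β[x⊕u][x⊕u⊕y]≡true = begin
      β (x ⊕ u) ((x ⊕ u) ⊕ y)                              ≡⟨ cong (β (x ⊕ u)) (⊕-right-comm x u y) ⟩
      β (x ⊕ u) ((x ⊕ y) ⊕ u)                              ≡⟨ β-⊕ˡ x u _ ⟩
      β x ((x ⊕ y) ⊕ u) xor β u ((x ⊕ y) ⊕ u)              ≡⟨ cong₂ _xor_ (β-⊕ʳ x (x ⊕ y) u) (β-⊕ʳ u (x ⊕ y) u) ⟩
      (β x (x ⊕ y) xor β x u) xor (β u (x ⊕ y) xor β u u)  ≡⟨ cong₂ (λ s t → (s xor β x u) xor (t xor β u u)) βx[x⊕y]≡false βu[x⊕y]≡false ⟩
      β x u xor β u u                                      ≡⟨ cong₂ _xor_ βxu≡true (β-self≡false (inj₂ Qu≡2)) ⟩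
      true                                                 ∎

  same-Q⇒moves : ∀ {c x y} → Characteristic c → x ≢ 0ᴱ → y ≢ 0ᴱ → x ≢ c → y ≢ c → Q x ≡ Q y → Moves x y
  same-Q⇒moves {c} {x} {y} c-char x≢0 y≢0 x≢c y≢c Qx≡Qy with β x (x ⊕ y) in βx[x⊕y]
  ... | true  = moves-by-transvection Qx≡Qy βx[x⊕y]
  ... | false = via (separate (x ⊕ y ∷ c ∷ []) x (x∉span[x⊕y,c] x≢0 y≢0 x≢c y≢c))
    where
    via : (Σ (E₂ n) λ u → β u x ≡ true × Annihilates u (x ⊕ y ∷ c ∷ [])) → Moves x y
    via (u , βux≡true , βu[x⊕y]≡false ∷ βuc≡false ∷ []) =
      moves-via u Qx≡Qy βx[x⊕y] βux≡true βu[x⊕y]≡false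
        (a+a≡0⇒a≡0⊎a≡2 (Q u) (trans (Q-double u) (cong twice (trans (sym (c-char u)) βuc≡false))))

-- The ℤ/4-valued refinement of a finite quadratic form: Q x = 4 q(x) mod 4 and β x y = 2 (x,y) mod 2.

module ℤ₄Refinement {n : ℕ} (A : FQF n) where

  q-0-integral : Σ ℤ λ j → q A 0ᴱ ≡ ι j
  q-0-integral =
    let j , q0-0·0·q0≡ιj = q-homog A 0 0ᴱ
    in j , trans (solve 1 (λ x → x := x :- con 0ℚ :* con 0ℚ :* x) refl (q A 0ᴱ)) q0-0·0·q0≡ιj

  4q-integral : ∀ x → Σ ℤ λ a → Quarters a (q A x)
  4q-integral x =
    let j , q0≡ιj = q-0-integral
        k , q2x-4qx≡ιk = q-homog A 2 x
    in j ℤ.- k , quarters (begin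
      q A x ℚ.* ι (+ 4)
        ≡⟨ solve 2 (λ Q y → y :* con (ι (+ 4)) := Q :- (Q :- con (ι (+ 2)) :* con (ι (+ 2)) :* y)) refl (q A (2 ·ᴱ x)) (q A x) ⟩
      q A (2 ·ᴱ x) ℚ.- (q A (2 ·ᴱ x) ℚ.- ℕtoℚ 2 ℚ.* ℕtoℚ 2 ℚ.* q A x)
        ≡⟨ cong₂ ℚ._-_ (cong (q A) 2x≡0) q2x-4qx≡ιk ⟩
      q A 0ᴱ ℚ.- ι k
        ≡⟨ cong (ℚ._- ι k) q0≡ιj ⟩
      ι j ℚ.- ι k
        ≡⟨ trans (ι-+ j (ℤ.- k)) (cong (ι j ℚ.+_) (ι-neg k)) ⟨
      ι (j ℤ.- k) ∎)
    where
    open ≡-Reasoning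
    2x≡0 : 2 ·ᴱ x ≡ 0ᴱ
    2x≡0 = trans (cong (x ⊕_) (⊕-identityʳ x)) (⊕-self x)

  4q : E₂ n → ℤ
  4q x = proj₁ (4q-integral x)

  4q-quarters : ∀ x → Quarters (4q x) (q A x)
  4q-quarters x = proj₂ (4q-integral x)

  4b : E₂ n → E₂ n → ℤ
  4b x y = 4q (x ⊕ y) ℤ.- 4q x ℤ.- 4q y

  4b-quarters : ∀ x y → Quarters (4b x y) (b A x y)
  4b-quarters x y = quarters-- (quarters-- (4q-quarters (x ⊕ y)) (4q-quarters x)) (4q-quarters y)

  Qᴬ : E₂ n → ℤ₄
  Qᴬ x = [ 4q x ]

  Λ : E₂ n → E₂ n → ℤ₄
  Λ x y = [ 4b x y ]

  Qᴬ-⊕ : ∀ x y → Qᴬ (x ⊕ y) ≡ Qᴬ x +₄ Qᴬ y +₄ Λ x y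
  Qᴬ-⊕ x y = begin
    [ 4q (x ⊕ y) ]                 ≡⟨ cong [_] (polarization (4q (x ⊕ y)) (4q x) (4q y)) ⟩
    [ 4q x ℤ.+ 4q y ℤ.+ 4b x y ]   ≡⟨ [+] (4q x ℤ.+ 4q y) (4b x y) ⟩
    [ 4q x ℤ.+ 4q y ] +₄ Λ x y     ≡⟨ cong (_+₄ Λ x y) ([+] (4q x) (4q y)) ⟩
    Qᴬ x +₄ Qᴬ y +₄ Λ x y          ∎
    where
    open ≡-Reasoning
    polarization : ∀ k kx ky → k ≡ kx ℤ.+ ky ℤ.+ (k ℤ.- kx ℤ.- ky)
    polarization = solve-∀

  Λ-⊕ˡ : ∀ x y z → Λ (x ⊕ y) z ≡ Λ x z +₄ Λ y z
  Λ-⊕ˡ x y z = trans (≡[modℤ]⇒[]≡ (4b-quarters (x ⊕ y) z) (quarters-+ (4b-quarters x z) (4b-quarters y z)) (b-additiveˡ A x y z))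
                     ([+] (4b x z) (4b y z))

  Qᴬ-0 : Qᴬ 0ᴱ ≡ 0₄
  Qᴬ-0 = ≡[modℤ]⇒[]≡ (4q-quarters 0ᴱ) quarters-0
           (let j , q0≡ιj = q-0-integral in j , trans (solve 1 (λ x → x :- con 0ℚ := x) refl (q A 0ᴱ)) q0≡ιj)

  Λ-0ˡ : ∀ y → Λ 0ᴱ y ≡ 0₄
  Λ-0ˡ y = +₄-cancelˡ (Qᴬ y) (Λ 0ᴱ y) 0₄ (begin
    Qᴬ y +₄ Λ 0ᴱ y              ≡⟨ cong (λ t → t +₄ Qᴬ y +₄ Λ 0ᴱ y) Qᴬ-0 ⟨
    Qᴬ 0ᴱ +₄ Qᴬ y +₄ Λ 0ᴱ y     ≡⟨ Qᴬ-⊕ 0ᴱ y ⟨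
    Qᴬ (0ᴱ ⊕ y)                 ≡⟨ cong Qᴬ (⊕-identityˡ y) ⟩
    Qᴬ y                        ≡⟨ +₄-identityʳ (Qᴬ y) ⟨
    Qᴬ y +₄ 0₄                  ∎)
    where open ≡-Reasoning

  Λ+Λ≡0 : ∀ x y → Λ x y +₄ Λ x y ≡ 0₄
  Λ+Λ≡0 x y = trans (sym (Λ-⊕ˡ x x y)) (trans (cong (λ w → Λ w y) (⊕-self x)) (Λ-0ˡ y))

  βᴬ : E₂ n → E₂ n → Bool
  βᴬ x y = half (Λ x y)

  twice-βᴬ : ∀ x y → twice (βᴬ x y) ≡ Λ x y
  twice-βᴬ x y = twice-half (Λ x y) (Λ+Λ≡0 x y)

  refinement : QuadraticRefinement n
  refinement = record
    { Q               = Qᴬ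
    ; β               = βᴬ
    ; Q-⊕             = λ x y → trans (Qᴬ-⊕ x y) (cong (Qᴬ x +₄ Qᴬ y +₄_) (sym (twice-βᴬ x y)))
    ; β-⊕ˡ            = λ x y z → twice-injective (begin
        twice (βᴬ (x ⊕ y) z)               ≡⟨ twice-βᴬ (x ⊕ y) z ⟩
        Λ (x ⊕ y) z                        ≡⟨ Λ-⊕ˡ x y z ⟩
        Λ x z +₄ Λ y z                     ≡⟨ cong₂ _+₄_ (twice-βᴬ x z) (twice-βᴬ y z) ⟨
        twice (βᴬ x z) +₄ twice (βᴬ y z)   ≡⟨ twice-xor (βᴬ x z) (βᴬ y z) ⟨
        twice (βᴬ x z xor βᴬ y z)          ∎)
    ; β-nondegenerate = λ x βx≡false → b-nondeg A x λ y →
        []≡⇒≡[modℤ] (4b-quarters x y) quarters-0 (trans (sym (twice-βᴬ x y)) (cong twice (βx≡false y)))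
    }
    where open ≡-Reasoning

  open QuadraticRefinementProperties refinement using (Q-double; same-Q⇒moves)

  characteristic : ∀ {c} → IsCharacteristic A c → QuadraticRefinement.Characteristic refinement c
  characteristic {c} c-char z = twice-injective (begin
    twice (βᴬ z c)          ≡⟨ twice-βᴬ z c ⟩
    Λ z c                   ≡⟨ ≡[modℤ]⇒[]≡ (4b-quarters z c) (quarters-double (4q-quarters z)) (c-char z) ⟩
    [ 4q z ℤ.+ 4q z ]       ≡⟨ [+] (4q z) (4q z) ⟩
    Qᴬ z +₄ Qᴬ z            ≡⟨ Q-double z ⟩
    twice (βᴬ z z)          ∎)
    where open ≡-Reasoning

  toOrth : Isometry refinement → Orth A
  toOrth g = record
    { iso         = Isometry.bijection g
    ; additive    = Isometry.⊕-homo g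
    ; preserves-q = λ x → []≡⇒≡[modℤ] (4q-quarters _) (4q-quarters x) (Isometry.preserves-Q g x)
    }

  same-norm⇒same-orbit : ∀ {c x y} → IsCharacteristic A c → x ≢ 0ᴱ → y ≢ 0ᴱ → x ≢ c → y ≢ c →
                         norm A x ≡[mod2ℤ] norm A y → SameOrbit A x y
  same-norm⇒same-orbit {c} {x} {y} c-char x≢0 y≢0 x≢c y≢c nx≡ny =
    let g , gx≡y = same-Q⇒moves (characteristic c-char) x≢0 y≢0 x≢c y≢c
                     (≡[modℤ]⇒[]≡ (4q-quarters x) (4q-quarters y) (2*≡[mod2ℤ]⇒≡[modℤ] {q A x} {q A y} nx≡ny))
    in toOrth g , gx≡y

same-orbit⇒same-norm : ∀ {n} (A : FQF n) {x y} → SameOrbit A x y → norm A x ≡[mod2ℤ] norm A y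
same-orbit⇒same-norm A {x} {y} (g , gx≡y) =
  ≡[modℤ]⇒2*≡[mod2ℤ] {q A x} {q A y} (≡[modℤ]-sym {q A y} {q A x} (subst (λ w → q A w ≡[modℤ] q A x) gx≡y (preserves-q g x)))

proposition4p3 : ∀ {n : ℕ} (A : FQF n) (xA : E₂ n) → IsCharacteristic A xA →
    ∀ (x y : E₂ n) → x ≢ 0ᴱ → y ≢ 0ᴱ → x ≢ xA → y ≢ xA →
    (SameOrbit A x y → norm A x ≡[mod2ℤ] norm A y) ×
    (norm A x ≡[mod2ℤ] norm A y → SameOrbit A x y)
proposition4p3 A xA xA-char x y x≢0 y≢0 x≢xA y≢xA =
  same-orbit⇒same-norm A , ℤ₄Refinement.same-norm⇒same-orbit A xA-char x≢0 y≢0 x≢xA y≢xA
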